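{- Let $q\ge 5$ be a prime and $r,s\ge 2$ integers. Then $\chi_D(LG_q\otimes K_{r,s})=r+s+1$.
   Context: Let $V=\mathbb{F}_q^3$, $\mathcal{P}$ the set of $1$-dimensional subspaces of $V$ (points) and $\mathcal{L}$ the set of $2$-dimensional subspaces (lines). For positive integers $r,s$, the graph $LG_q\otimes K_{r,s}$ has vertex set $(\mathcal{P}\times[r])\sqcup(\mathcal{L}\times[s])$, where $[m]=\{1,\dots,m\}$, and for $p\in\mathcal{P}$, $l\in\mathcal{L}$, $(i,j)\in[r]\times[s]$, the vertex $(p,i)$ is adjacent to $(l,j)$ iff $p\subseteq l$; there are no other edges. The distinguishing chromatic number $\chi_D(G)$ is the least number of colors in a proper vertex coloring of $G$ such that the only automorphism of $G$ mapping every color class onto itself is the identity. -}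

module Defs where

open import Data.Nat using (ℕ; NonZero; _<_)
open import Data.Nat.DivMod using (_mod_)
open import Data.Fin using (Fin; toℕ)
open import Data.Bool using (Bool; T; _∧_; _∨_)
open import Data.Nat using (_≡ᵇ_)
open import Data.Product using (Σ; ∃; ∃-syntax; _×_; _,_; proj₁)
open import Data.Sum using (_⊎_; inj₁; inj₂)
open import Data.Empty using (⊥)
open import Relation.Nullary using (¬_)
open import Relation.Binary.PropositionalEquality using (_≡_; _≢_)
open import Function.Bundles using (_↔_; _⇔_; Inverse)

record Graph : Set₁ where
  field
    Vertex : Set
    Adj    : Vertex → Vertex → Set

open Graph public

record Automorphism (G : Graph) : Set where
  field
    perm     : Vertex G ↔ Vertex G
    preserve : ∀ u v → Adj G u v ⇔ Adj G (Inverse.to perm u) (Inverse.to perm v)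

open Automorphism public

apply : {G : Graph} → Automorphism G → Vertex G → Vertex G
apply σ = Inverse.to (perm σ)

IsProperColoring : (G : Graph) (k : ℕ) → (Vertex G → Fin k) → Set
IsProperColoring G k c = ∀ u v → Adj G u v → c u ≢ c v

IsDistinguishing : (G : Graph) (k : ℕ) → (Vertex G → Fin k) → Set
IsDistinguishing G k c =
  (σ : Automorphism G) → (∀ v → c (apply σ v) ≡ c v) → ∀ v → apply σ v ≡ v

HasDistinguishingColoring : Graph → ℕ → Set
HasDistinguishingColoring G k =
  Σ (Vertex G → Fin k) λ c → IsProperColoring G k c × IsDistinguishing G k c

DistChromaticNumber≡ : Graph → ℕ → Set
DistChromaticNumber≡ G k =
  HasDistinguishingColoring G k × (∀ m → m < k → ¬ HasDistinguishingColoring G m)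

module PG (q : ℕ) {{nz : NonZero q}} where

  F : Set
  F = Fin q

  _+F_ : F → F → F
  a +F b = (toℕ a Data.Nat.+ toℕ b) mod q

  _*F_ : F → F → F
  a *F b = (toℕ a Data.Nat.* toℕ b) mod q

  isZ isOne : F → Bool
  isZ a = toℕ a ≡ᵇ 0
  isOne a = toℕ a ≡ᵇ 1

  V : Set
  V = F × F × F

  _·_ : F → V → V
  c · (x , y , z) = (c *F x) , (c *F y) , (c *F z)

  _⊕_ : V → V → V
  (x , y , z) ⊕ (x' , y' , z') = (x +F x') , (y +F y') , (z +F z')

  -- A 1-dimensional subspace is represented by its unique basis vector in
  -- reduced row echelon form (nonzero, leading nonzero entry = 1).
  rref1 : V → Bool
  rref1 (a , b , c) = isOne a ∨ (isZ a ∧ isOne b) ∨ (isZ a ∧ isZ b ∧ isOne c)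

  -- A 2-dimensional subspace is represented by its unique basis (2×3 matrix)
  -- in reduced row echelon form; pivot columns {1,2}, {1,3} or {2,3}.
  rref2 : V × V → Bool
  rref2 ((a₁ , b₁ , c₁) , (a₂ , b₂ , c₂)) =
      (isOne a₁ ∧ isZ b₁ ∧ isZ a₂ ∧ isOne b₂)
    ∨ (isOne a₁ ∧ isZ c₁ ∧ isZ a₂ ∧ isZ b₂ ∧ isOne c₂)
    ∨ (isZ a₁ ∧ isOne b₁ ∧ isZ c₁ ∧ isZ a₂ ∧ isZ b₂ ∧ isOne c₂)

  Point : Set
  Point = Σ V λ v → T (rref1 v)

  Line : Set
  Line = Σ (V × V) λ m → T (rref2 m)

  _∈P_ : V → Point → Set
  x ∈P (v , _) = ∃[ c ] x ≡ c · v

  _∈L_ : V → Line → Set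
  x ∈L ((u , w) , _) = ∃[ a ] ∃[ b ] x ≡ (a · u) ⊕ (b · w)

  _⊆_ : Point → Line → Set
  p ⊆ l = ∀ x → x ∈P p → x ∈L l

  LGK : ℕ → ℕ → Graph
  LGK r s = record
    { Vertex = (Point × Fin r) ⊎ (Line × Fin s)
    ; Adj    = adj
    }
    where
    adj : (Point × Fin r) ⊎ (Line × Fin s) → (Point × Fin r) ⊎ (Line × Fin s) → Set
    adj (inj₁ (p , _)) (inj₂ (l , _)) = p ⊆ l
    adj (inj₂ (l , _)) (inj₁ (p , _)) = p ⊆ l
    adj (inj₁ _) (inj₁ _) = ⊥
    adj (inj₂ _) (inj₂ _) = ⊥

module Submission where

-- Colour the copies of points with r colours and those of lines
-- with s others, except that the five pairwise non-incident special vertices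
-- O = [1:0:0], Z = [0:0:1], Y = [0:1:0], L₁ : z = y − x and L₂ : z = y + x each
-- trade one of their colours, chosen to tell them apart up to {O , Z}, for one
-- extra colour.  A colour-preserving automorphism sends copies of a vertex to
-- copies of a vertex and so induces a collineation fixing Y, L₁, L₂ and the pair
-- {O , Z}; joining and meeting from these fixed elements reaches every point,
-- so the collineation, and then the automorphism, is the identity.
--
-- Copies of one vertex are twins, so in a distinguishing colouring
-- they get distinct colours and an incident point and line need r + s colours.
-- With only r + s colours, two points on a common line therefore carry the same
-- set of colours, as do two lines through a common point, and the elation
-- (x , y , z) ↦ (x , y , z + x) lifts to a non-trivial colour-preserving
-- automorphism.

open import Defs
open import Data.Nat using (ℕ; NonZero; _≤_; _+_)
open import Data.Nat.Primality using (Prime)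

open import Data.Bool using (T; _∧_; _∨_)
open import Data.Bool.Properties using (T-∧; T-∨; T-irrelevant)
open import Data.Empty using (⊥; ⊥-elim)
open import Data.Fin as Fin using (Fin; toℕ; punchIn)
import Data.Fin.Properties as Fin
open import Data.Nat using (zero; suc; _*_; _∸_; _%_; _<_; s≤s; z≤n)
open import Data.Nat.DivMod using (_mod_; m%n<n; %-distribˡ-+; %-distribˡ-*; m<n⇒m%n≡m; n%n≡0; m%n%n≡m%n)
import Data.Nat.Properties as ℕ
open import Data.Product using (Σ; ∃; ∃-syntax; _×_; _,_; proj₁; proj₂)
open import Data.Product.Function.NonDependent.Propositional using (_×-↔_)
open import Data.Product.Properties using () renaming (≡-dec to Σ-≡-dec)
open import Data.Sum as Sum using (_⊎_; inj₁; inj₂; [_,_]′)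
open import Data.Sum.Function.Propositional using (_⊎-↔_)
import Data.Sum.Properties as Sum
open import Data.Unit using (⊤; tt)
open import Function.Base using (id; _∘_; case_of_)
open import Function.Bundles using (_⇔_; _↔_; mk⇔; Equivalence; Inverse; mk↔ₛ′)
open import Function.Construct.Composition using (_⇔-∘_; _↔-∘_)
open import Function.Construct.Identity using (⇔-id; ↔-id)
open import Function.Construct.Symmetry using (⇔-sym; ↔-sym)
open import Relation.Binary.Definitions using (DecidableEquality)
open import Relation.Binary.PropositionalEquality
open import Relation.Nullary using (¬_; yes; no)
open import Relation.Nullary.Decidable using (map′)

T∧ : ∀ {a b} → T (a ∧ b) → T a × T b
T∧ = Equivalence.to T-∧

T∨ : ∀ {a b} → T (a ∨ b) → T a ⊎ T b
T∨ = Equivalence.to T-∨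

injective⇒surjective : ∀ {m n} → m ≤ n → (f : Fin n → Fin m) → (∀ {x y} → f x ≡ f y → x ≡ y) →
                       ∀ y → ∃ λ x → f x ≡ y
injective⇒surjective {suc _} m≤n f f-injective y with Fin.any? (λ x → f x Fin.≟ y)
... | yes hit = hit
... | no miss
  with i , j , i<j , gi≡gj ← Fin.pigeonhole m≤n (λ x → Fin.punchOut (miss ∘ (x ,_) ∘ sym))
  = ⊥-elim (Fin.<⇒≢ i<j (f-injective (Fin.punchOut-injective (miss ∘ (i ,_) ∘ sym) (miss ∘ (j ,_) ∘ sym) gi≡gj)))

join-injective : ∀ m n {a b} → Fin.join m n a ≡ Fin.join m n b → a ≡ b
join-injective m n {a} {b} e = trans (sym (Fin.splitAt-join m n a)) (trans (cong (Fin.splitAt m) e) (Fin.splitAt-join m n b))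

splitAt-injective : ∀ m n {a b} → Fin.splitAt m {n} a ≡ Fin.splitAt m b → a ≡ b
splitAt-injective m n {a} {b} e = trans (sym (Fin.join-splitAt m n a)) (trans (cong (Fin.join m n) e) (Fin.join-splitAt m n b))

punchIn≡zero⇒≢zero : ∀ {k} (a : Fin (suc k)) i → punchIn a i ≡ Fin.zero → a ≢ Fin.zero
punchIn≡zero⇒≢zero Fin.zero _ () refl
punchIn≡zero⇒≢zero (Fin.suc _) _ _ ()

punchIn-image⇒≡ : ∀ {k} (a b : Fin (suc k)) (φ : Fin k → Fin k) → (∀ i → punchIn b (φ i) ≡ punchIn a i) → a ≡ b
punchIn-image⇒≡ a b φ h with a Fin.≟ b
... | yes a≡b = a≡b
... | no a≢b = ⊥-elim (Fin.punchInᵢ≢i b (φ i) (trans (h i) (Fin.punchIn-punchOut a≢b)))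
  where i = Fin.punchOut a≢b

Twins : (G : Graph) → Vertex G → Vertex G → Set
Twins G u v = ∀ w → (Adj G u w ⇔ Adj G v w) × (Adj G w u ⇔ Adj G w v)

module _ {G : Graph} where

  twins-refl : ∀ u → Twins G u u
  twins-refl u w = ⇔-id _ , ⇔-id _

  twins-sym : ∀ {u v} → Twins G u v → Twins G v u
  twins-sym t w = ⇔-sym (proj₁ (t w)) , ⇔-sym (proj₂ (t w))

  module Swap (_≟_ : DecidableEquality (Vertex G)) (u v : Vertex G) where

    swap : Vertex G → Vertex G
    swap x with x ≟ u
    ... | yes _ = v
    ... | no _ with x ≟ v
    ...   | yes _ = u
    ...   | no _ = x

    swap-involutive : ∀ x → swap (swap x) ≡ x
    swap-involutive x with x ≟ u
    swap-involutive x | yes refl with v ≟ x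
    ... | yes v≡x = v≡x
    ... | no _ with v ≟ v
    ...   | yes _ = refl
    ...   | no v≢v = ⊥-elim (v≢v refl)
    swap-involutive x | no x≢u with x ≟ v
    swap-involutive x | no x≢u | yes refl with u ≟ u
    ... | yes _ = refl
    ... | no u≢u = ⊥-elim (u≢u refl)
    swap-involutive x | no x≢u | no x≢v with x ≟ u
    ... | yes x≡u = ⊥-elim (x≢u x≡u)
    ... | no _ with x ≟ v
    ...   | yes x≡v = ⊥-elim (x≢v x≡v)
    ...   | no _ = refl

    swap-u : swap u ≡ v
    swap-u with u ≟ u
    ... | yes _ = refl
    ... | no u≢u = ⊥-elim (u≢u refl)

    module _ (uv-twins : Twins G u v) where

      swap-twins : ∀ x → Twins G x (swap x)
      swap-twins x with x ≟ u
      ... | yes refl = uv-twins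
      ... | no _ with x ≟ v
      ...   | yes refl = twins-sym uv-twins
      ...   | no _ = twins-refl x

      swap-automorphism : Automorphism G
      swap-automorphism = record
        { perm = mk↔ₛ′ swap swap swap-involutive swap-involutive
        ; preserve = λ x y → proj₂ (swap-twins y (swap x)) ⇔-∘ proj₁ (swap-twins x y)
        }

    swap-preserves : ∀ {k} (c : Vertex G → Fin k) → c u ≡ c v → ∀ x → c (swap x) ≡ c x
    swap-preserves c e x with x ≟ u
    ... | yes refl = sym e
    ... | no _ with x ≟ v
    ...   | yes refl = e
    ...   | no _ = refl

  distinguishing-separates-twins : DecidableEquality (Vertex G) →
    ∀ {k} (c : Vertex G → Fin k) → IsDistinguishing G k c →
    ∀ {u v} → Twins G u v → c u ≡ c v → u ≡ v
  distinguishing-separates-twins _≟_ c dist {u} {v} t e =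
    sym (trans (sym swap-u) (dist (swap-automorphism t) (swap-preserves c e) u))
    where open Swap _≟_ u v

  Adj-apply : (σ : Automorphism G) → ∀ x w → Adj G (apply σ x) w ⇔ Adj G x (Inverse.from (perm σ) w)
  Adj-apply σ x w = subst (λ z → Adj G (apply σ x) z ⇔ Adj G x (Inverse.from (perm σ) w))
                      (Inverse.strictlyInverseˡ (perm σ) w) (⇔-sym (preserve σ x (Inverse.from (perm σ) w)))

  Adj-applyʳ : (σ : Automorphism G) → ∀ x w → Adj G w (apply σ x) ⇔ Adj G (Inverse.from (perm σ) w) x
  Adj-applyʳ σ x w = subst (λ z → Adj G z (apply σ x) ⇔ Adj G (Inverse.from (perm σ) w) x)
                       (Inverse.strictlyInverseˡ (perm σ) w) (⇔-sym (preserve σ (Inverse.from (perm σ) w) x))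

  apply-twins : (σ : Automorphism G) → ∀ {u v} → Twins G u v → Twins G (apply σ u) (apply σ v)
  apply-twins σ {u} {v} t w =
    ⇔-sym (Adj-apply σ v w) ⇔-∘ (proj₁ (t w′) ⇔-∘ Adj-apply σ u w) ,
    ⇔-sym (Adj-applyʳ σ v w) ⇔-∘ (proj₂ (t w′) ⇔-∘ Adj-applyʳ σ u w)
    where w′ = Inverse.from (perm σ) w

  unapply-twins : (σ : Automorphism G) → ∀ {u v} → Twins G (apply σ u) (apply σ v) → Twins G u v
  unapply-twins σ {u} {v} t w =
    ⇔-sym (preserve σ v w) ⇔-∘ (proj₁ (t (apply σ w)) ⇔-∘ preserve σ u w) ,
    ⇔-sym (preserve σ w v) ⇔-∘ (proj₂ (t (apply σ w)) ⇔-∘ preserve σ w u)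

module ColourMatching {A : Set} {k m : ℕ} (c : A → Fin k → Fin m) (c-injective : ∀ a {i j} → c a i ≡ c a j → i ≡ j)
                      (f f⁻¹ : A → A) (f∘f⁻¹ : ∀ a → f (f⁻¹ a) ≡ a) (f⁻¹∘f : ∀ a → f⁻¹ (f a) ≡ a)
                      (f-shares : ∀ a i → ∃ λ i′ → c (f a) i′ ≡ c a i)
                      (f⁻¹-shares : ∀ a i → ∃ λ i′ → c (f⁻¹ a) i′ ≡ c a i) where

  lift lift⁻¹ : A × Fin k → A × Fin k
  lift (a , i) = f a , proj₁ (f-shares a i)
  lift⁻¹ (a , i) = f⁻¹ a , proj₁ (f⁻¹-shares a i)

  lift-colour : ∀ a i → c (f a) (proj₂ (lift (a , i))) ≡ c a i
  lift-colour a i = proj₂ (f-shares a i)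

  same-copy : ∀ {a b i j} → b ≡ a → c b j ≡ c a i → (b , j) ≡ (a , i)
  same-copy {a} refl e = cong (a ,_) (c-injective a e)

  matching : (A × Fin k) ↔ (A × Fin k)
  matching = mk↔ₛ′ lift lift⁻¹
    (λ (a , i) → same-copy (f∘f⁻¹ a) (trans (lift-colour (f⁻¹ a) _) (proj₂ (f⁻¹-shares a i))))
    (λ (a , i) → same-copy (f⁻¹∘f a) (trans (proj₂ (f⁻¹-shares (f a) _)) (lift-colour a i)))

module ModularArithmetic (k : ℕ) where
  q : ℕ
  q = 2 + k

  open PG q public

  pattern 0F = Fin.zero
  pattern 1F = Fin.suc Fin.zero

  ⟦_⟧ : ℕ → F
  ⟦ m ⟧ = m mod q

  -F_ : F → F
  -F a = ⟦ q ∸ toℕ a ⟧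

  toℕ-⟦⟧ : ∀ m → toℕ ⟦ m ⟧ ≡ m % q
  toℕ-⟦⟧ m = Fin.toℕ-fromℕ< (m%n<n m q)

  ⟦⟧-toℕ : ∀ a → ⟦ toℕ a ⟧ ≡ a
  ⟦⟧-toℕ a = Fin.toℕ-injective (trans (toℕ-⟦⟧ (toℕ a)) (m<n⇒m%n≡m (Fin.toℕ<n a)))

  ⟦⟧-% : ∀ m → ⟦ m % q ⟧ ≡ ⟦ m ⟧
  ⟦⟧-% m = Fin.toℕ-injective (trans (toℕ-⟦⟧ (m % q)) (trans (m%n%n≡m%n m q) (sym (toℕ-⟦⟧ m))))

  ⟦⟧-homo : (_∙_ : ℕ → ℕ → ℕ) → (∀ m n → (m ∙ n) % q ≡ ((m % q) ∙ (n % q)) % q) →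
            ∀ m n → ⟦ toℕ ⟦ m ⟧ ∙ toℕ ⟦ n ⟧ ⟧ ≡ ⟦ m ∙ n ⟧
  ⟦⟧-homo _∙_ distrib m n = begin
    ⟦ toℕ ⟦ m ⟧ ∙ toℕ ⟦ n ⟧ ⟧     ≡⟨ cong₂ (λ x y → ⟦ x ∙ y ⟧) (toℕ-⟦⟧ m) (toℕ-⟦⟧ n) ⟩
    ⟦ (m % q) ∙ (n % q) ⟧         ≡⟨ ⟦⟧-% ((m % q) ∙ (n % q)) ⟨
    ⟦ ((m % q) ∙ (n % q)) % q ⟧   ≡⟨ cong ⟦_⟧ (distrib m n) ⟨
    ⟦ (m ∙ n) % q ⟧               ≡⟨ ⟦⟧-% (m ∙ n) ⟩
    ⟦ m ∙ n ⟧                     ∎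
    where open ≡-Reasoning

  ⟦⟧-+ : ∀ m n → ⟦ m ⟧ +F ⟦ n ⟧ ≡ ⟦ m + n ⟧
  ⟦⟧-+ m n = ⟦⟧-homo _+_ (λ x y → %-distribˡ-+ x y q) m n

  ⟦⟧-* : ∀ m n → ⟦ m ⟧ *F ⟦ n ⟧ ≡ ⟦ m * n ⟧
  ⟦⟧-* m n = ⟦⟧-homo _*_ (λ x y → %-distribˡ-* x y q) m n

  +F-comm : ∀ a b → a +F b ≡ b +F a
  +F-comm a b = cong ⟦_⟧ (ℕ.+-comm (toℕ a) (toℕ b))

  +F-assoc : ∀ a b c → (a +F b) +F c ≡ a +F (b +F c)
  +F-assoc a b c = begin
    ⟦ x + y ⟧ +F c        ≡⟨ cong (⟦ x + y ⟧ +F_) (⟦⟧-toℕ c) ⟨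
    ⟦ x + y ⟧ +F ⟦ z ⟧    ≡⟨ ⟦⟧-+ (x + y) z ⟩
    ⟦ x + y + z ⟧         ≡⟨ cong ⟦_⟧ (ℕ.+-assoc x y z) ⟩
    ⟦ x + (y + z) ⟧       ≡⟨ ⟦⟧-+ x (y + z) ⟨
    ⟦ x ⟧ +F ⟦ y + z ⟧    ≡⟨ cong (_+F (b +F c)) (⟦⟧-toℕ a) ⟩
    a +F (b +F c)         ∎
    where open ≡-Reasoning; x = toℕ a; y = toℕ b; z = toℕ c

  *F-assoc : ∀ a b c → (a *F b) *F c ≡ a *F (b *F c)
  *F-assoc a b c = begin
    ⟦ x * y ⟧ *F c        ≡⟨ cong (⟦ x * y ⟧ *F_) (⟦⟧-toℕ c) ⟨
    ⟦ x * y ⟧ *F ⟦ z ⟧    ≡⟨ ⟦⟧-* (x * y) z ⟩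
    ⟦ x * y * z ⟧         ≡⟨ cong ⟦_⟧ (ℕ.*-assoc x y z) ⟩
    ⟦ x * (y * z) ⟧       ≡⟨ ⟦⟧-* x (y * z) ⟨
    ⟦ x ⟧ *F ⟦ y * z ⟧    ≡⟨ cong (_*F (b *F c)) (⟦⟧-toℕ a) ⟩
    a *F (b *F c)         ∎
    where open ≡-Reasoning; x = toℕ a; y = toℕ b; z = toℕ c

  *F-distribˡ-+F : ∀ a b c → a *F (b +F c) ≡ (a *F b) +F (a *F c)
  *F-distribˡ-+F a b c = begin
    a *F ⟦ y + z ⟧            ≡⟨ cong (_*F ⟦ y + z ⟧) (⟦⟧-toℕ a) ⟨
    ⟦ x ⟧ *F ⟦ y + z ⟧        ≡⟨ ⟦⟧-* x (y + z) ⟩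
    ⟦ x * (y + z) ⟧           ≡⟨ cong ⟦_⟧ (ℕ.*-distribˡ-+ x y z) ⟩
    ⟦ x * y + x * z ⟧         ≡⟨ ⟦⟧-+ (x * y) (x * z) ⟨
    (a *F b) +F (a *F c)      ∎
    where open ≡-Reasoning; x = toℕ a; y = toℕ b; z = toℕ c

  +F-identityʳ : ∀ a → a +F 0F ≡ a
  +F-identityʳ a = trans (cong ⟦_⟧ (ℕ.+-identityʳ (toℕ a))) (⟦⟧-toℕ a)

  +F-identityˡ : ∀ a → 0F +F a ≡ a
  +F-identityˡ a = ⟦⟧-toℕ a

  *F-identityʳ : ∀ a → a *F 1F ≡ a
  *F-identityʳ a = trans (cong ⟦_⟧ (ℕ.*-identityʳ (toℕ a))) (⟦⟧-toℕ a)

  *F-identityˡ : ∀ a → 1F *F a ≡ a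
  *F-identityˡ a = trans (cong ⟦_⟧ (ℕ.+-identityʳ (toℕ a))) (⟦⟧-toℕ a)

  *F-zeroʳ : ∀ a → a *F 0F ≡ 0F
  *F-zeroʳ a = cong ⟦_⟧ (ℕ.*-zeroʳ (toℕ a))

  +F-inverseʳ : ∀ a → a +F (-F a) ≡ 0F
  +F-inverseʳ a = begin
    a +F ⟦ q ∸ x ⟧          ≡⟨ cong (_+F ⟦ q ∸ x ⟧) (⟦⟧-toℕ a) ⟨
    ⟦ x ⟧ +F ⟦ q ∸ x ⟧      ≡⟨ ⟦⟧-+ x (q ∸ x) ⟩
    ⟦ x + (q ∸ x) ⟧         ≡⟨ cong ⟦_⟧ (ℕ.m+[n∸m]≡n (ℕ.<⇒≤ (Fin.toℕ<n a))) ⟩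
    ⟦ q ⟧                   ≡⟨ Fin.toℕ-injective (trans (toℕ-⟦⟧ q) (n%n≡0 q)) ⟩
    0F                      ∎
    where open ≡-Reasoning; x = toℕ a

  +F-inverseˡ : ∀ a → (-F a) +F a ≡ 0F
  +F-inverseˡ a = trans (+F-comm (-F a) a) (+F-inverseʳ a)

  [a+b]-b≡a : ∀ a b → (a +F b) +F (-F b) ≡ a
  [a+b]-b≡a a b = trans (+F-assoc a b (-F b)) (trans (cong (a +F_) (+F-inverseʳ b)) (+F-identityʳ a))

  [a-b]+b≡a : ∀ a b → (a +F (-F b)) +F b ≡ a
  [a-b]+b≡a a b = trans (+F-assoc a (-F b) b) (trans (cong (a +F_) (+F-inverseˡ b)) (+F-identityʳ a))

  +F-cancelʳ : ∀ a b c → b +F a ≡ c +F a → b ≡ c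
  +F-cancelʳ a b c e = trans (sym ([a+b]-b≡a b a)) (trans (cong (_+F (-F a)) e) ([a+b]-b≡a c a))

  +F≡0⇒≡-F : ∀ a b → a +F b ≡ 0F → a ≡ -F b
  +F≡0⇒≡-F a b e = +F-cancelʳ b a (-F b) (trans e (sym (+F-inverseˡ b)))

  -F-cancelˡ : ∀ a b → a +F ((-F a) +F b) ≡ b
  -F-cancelˡ a b = begin
    a +F ((-F a) +F b)       ≡⟨ +F-assoc a (-F a) b ⟨
    (a +F (-F a)) +F b       ≡⟨ cong (_+F b) (+F-inverseʳ a) ⟩
    0F +F b                  ≡⟨ +F-identityˡ b ⟩
    b                        ∎
    where open ≡-Reasoning

  a+b*0≡a : ∀ a b → a +F (b *F 0F) ≡ a
  a+b*0≡a a b = trans (cong (a +F_) (*F-zeroʳ b)) (+F-identityʳ a)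

  a*0+b≡b : ∀ a b → (a *F 0F) +F b ≡ b
  a*0+b≡b a b = trans (cong (_+F b) (*F-zeroʳ a)) (+F-identityˡ b)

  a+b*1≡a+b : ∀ a b → a +F (b *F 1F) ≡ a +F b
  a+b*1≡a+b a b = cong (a +F_) (*F-identityʳ b)

  c≡-a+b⇒b≡a+c : ∀ a b c → c ≡ (-F a) +F b → b ≡ a +F c
  c≡-a+b⇒b≡a+c a b c e = trans (sym (-F-cancelˡ a b)) (cong (a +F_) (sym e))

  -a+[a+1]≡1 : ∀ a → (-F a) +F (a +F 1F) ≡ 1F
  -a+[a+1]≡1 a = begin
    (-F a) +F (a +F 1F)      ≡⟨ +F-assoc (-F a) a 1F ⟨
    ((-F a) +F a) +F 1F      ≡⟨ cong (_+F 1F) (+F-inverseˡ a) ⟩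
    0F +F 1F                 ≡⟨ +F-identityˡ 1F ⟩
    1F                       ∎
    where open ≡-Reasoning

  [a+b]+c≡[a+c]+b : ∀ a b c → (a +F b) +F c ≡ (a +F c) +F b
  [a+b]+c≡[a+c]+b a b c = trans (+F-assoc a b c) (trans (cong (a +F_) (+F-comm b c)) (sym (+F-assoc a c b)))


  ⟦suc⟧ : ∀ m → ⟦ m ⟧ +F 1F ≡ ⟦ 1 + m ⟧
  ⟦suc⟧ m = trans (⟦⟧-+ m 1) (cong ⟦_⟧ (ℕ.+-comm m 1))

-- Projective coordinates in the affine chart x = 1: the point pt₁ b c is the
-- affine point (b , c), pt₂ c is the point at infinity of slope c and pt₃ the
-- vertical one; ln₁₂ c₁ c₂ is the line c = c₁ + c₂ b, ln₁₃ b the vertical line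
-- through (b , _) and ln₂₃ the line at infinity.  The subscripts are the pivot
-- columns of the reduced row echelon forms used in Defs.
module Plane (n : ℕ) where
  open ModularArithmetic (suc n) public

  -1F : F
  -1F = -F 1F

  toℕ[-1F]≡2+n : toℕ -1F ≡ 2 + n
  toℕ[-1F]≡2+n = trans (toℕ-⟦⟧ (2 + n)) (m<n⇒m%n≡m ℕ.≤-refl)

  -1F≢1F : -1F ≢ 1F
  -1F≢1F e with trans (sym toℕ[-1F]≡2+n) (cong toℕ e)
  ... | ()

  1F≢0F : _≢_ {A = F} 1F 0F
  1F≢0F ()

  -1F≢0F : -1F ≢ 0F
  -1F≢0F e with trans (sym toℕ[-1F]≡2+n) (cong toℕ e)
  ... | ()

  data Pt : Set where
    pt₁ : F → F → Pt
    pt₂ : F → Pt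
    pt₃ : Pt

  data Ln : Set where
    ln₁₂ : F → F → Ln
    ln₁₃ : F → Ln
    ln₂₃ : Ln

  toPoint : Pt → Point
  toPoint (pt₁ b c) = (1F , b , c) , tt
  toPoint (pt₂ c) = (0F , 1F , c) , tt
  toPoint pt₃ = (0F , 0F , 1F) , tt

  classifyPoint : (p : Point) → Σ Pt λ x → toPoint x ≡ p
  classifyPoint ((1F , b , c) , _) = pt₁ b c , refl
  classifyPoint ((0F , 1F , c) , _) = pt₂ c , refl
  classifyPoint ((0F , 0F , 1F) , _) = pt₃ , refl
  classifyPoint ((0F , 0F , 0F) , ())
  classifyPoint ((0F , 0F , Fin.suc (Fin.suc _)) , ())
  classifyPoint ((0F , Fin.suc (Fin.suc _) , _) , ())
  classifyPoint ((Fin.suc (Fin.suc _) , _ , _) , ())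

  fromPoint : Point → Pt
  fromPoint p = proj₁ (classifyPoint p)

  toPoint-fromPoint : ∀ p → toPoint (fromPoint p) ≡ p
  toPoint-fromPoint p = proj₂ (classifyPoint p)

  fromPoint-toPoint : ∀ x → fromPoint (toPoint x) ≡ x
  fromPoint-toPoint (pt₁ b c) = refl
  fromPoint-toPoint (pt₂ c) = refl
  fromPoint-toPoint pt₃ = refl

  ln₁₃-rref : ∀ b → T (rref2 ((1F , b , 0F) , (0F , 0F , 1F)))
  ln₁₃-rref 0F = tt
  ln₁₃-rref (Fin.suc _) = tt

  toLine : Ln → Line
  toLine (ln₁₂ c₁ c₂) = ((1F , 0F , c₁) , (0F , 1F , c₂)) , tt
  toLine (ln₁₃ b) = ((1F , b , 0F) , (0F , 0F , 1F)) , ln₁₃-rref b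
  toLine ln₂₃ = ((0F , 1F , 0F) , (0F , 0F , 1F)) , tt

  T-isOne : ∀ {a} → T (isOne a) → a ≡ 1F
  T-isOne {a} t = Fin.toℕ-injective (ℕ.≡ᵇ⇒≡ (toℕ a) 1 t)

  T-isZ : ∀ {a} → T (isZ a) → a ≡ 0F
  T-isZ {a} t = Fin.toℕ-injective (ℕ.≡ᵇ⇒≡ (toℕ a) 0 t)

  rows-≡ : ∀ {a₁ b₁ c₁ a₂ b₂ c₂ a₁′ b₁′ c₁′ a₂′ b₂′ c₂′ : F} →
           a₁′ ≡ a₁ → b₁′ ≡ b₁ → c₁′ ≡ c₁ → a₂′ ≡ a₂ → b₂′ ≡ b₂ → c₂′ ≡ c₂ →
           _≡_ {A = V × V} ((a₁′ , b₁′ , c₁′) , (a₂′ , b₂′ , c₂′)) ((a₁ , b₁ , c₁) , (a₂ , b₂ , c₂))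
  rows-≡ refl refl refl refl refl refl = refl

  line-≡ : ∀ {m m′ : V × V} {t : T (rref2 m)} {t′ : T (rref2 m′)} → m ≡ m′ → _≡_ {A = Line} (m , t) (m′ , t′)
  line-≡ {m} refl = cong (m ,_) (T-irrelevant _ _)

  classifyLine : (l : Line) → Σ Ln λ L → toLine L ≡ l
  classifyLine (((a₁ , b₁ , c₁) , (a₂ , b₂ , c₂)) , t) with T∨ t
  ... | inj₁ h
    with e₁ , h ← T∧ h
    with e₂ , h ← T∧ h
    with e₃ , e₄ ← T∧ h
    = ln₁₂ c₁ c₂ , line-≡ (rows-≡ (sym (T-isOne e₁)) (sym (T-isZ e₂)) refl
                                  (sym (T-isZ e₃)) (sym (T-isOne e₄)) refl)
  ... | inj₂ h with T∨ h
  ...   | inj₁ h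
    with e₁ , h ← T∧ h
    with e₂ , h ← T∧ h
    with e₃ , h ← T∧ h
    with e₄ , e₅ ← T∧ h
    = ln₁₃ b₁ , line-≡ (rows-≡ (sym (T-isOne e₁)) refl (sym (T-isZ e₂))
                               (sym (T-isZ e₃)) (sym (T-isZ e₄)) (sym (T-isOne e₅)))
  ...   | inj₂ h
    with e₁ , h ← T∧ h
    with e₂ , h ← T∧ h
    with e₃ , h ← T∧ h
    with e₄ , h ← T∧ h
    with e₅ , e₆ ← T∧ h
    = ln₂₃ , line-≡ (rows-≡ (sym (T-isZ e₁)) (sym (T-isOne e₂)) (sym (T-isZ e₃))
                            (sym (T-isZ e₄)) (sym (T-isZ e₅)) (sym (T-isOne e₆)))

  fromLine : Line → Ln
  fromLine l = proj₁ (classifyLine l)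

  toLine-fromLine : ∀ l → toLine (fromLine l) ≡ l
  toLine-fromLine l = proj₂ (classifyLine l)

  fromLine-toLine : ∀ L → fromLine (toLine L) ≡ L
  fromLine-toLine (ln₁₂ c₁ c₂) = refl
  fromLine-toLine (ln₁₃ 0F) = refl
  fromLine-toLine (ln₁₃ (Fin.suc _)) = refl
  fromLine-toLine ln₂₃ = refl

  toPoint-injective : ∀ {x y} → toPoint x ≡ toPoint y → x ≡ y
  toPoint-injective {x} {y} e = trans (sym (fromPoint-toPoint x)) (trans (cong fromPoint e) (fromPoint-toPoint y))

  fromPoint-injective : ∀ {p p′} → fromPoint p ≡ fromPoint p′ → p ≡ p′
  fromPoint-injective {p} {p′} e = trans (sym (toPoint-fromPoint p)) (trans (cong toPoint e) (toPoint-fromPoint p′))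

  toLine-injective : ∀ {L M} → toLine L ≡ toLine M → L ≡ M
  toLine-injective {L} {M} e = trans (sym (fromLine-toLine L)) (trans (cong fromLine e) (fromLine-toLine M))

  fromLine-injective : ∀ {l l′} → fromLine l ≡ fromLine l′ → l ≡ l′
  fromLine-injective {l} {l′} e = trans (sym (toLine-fromLine l)) (trans (cong toLine e) (toLine-fromLine l′))

  _≟V_ : DecidableEquality V
  _≟V_ = Σ-≡-dec Fin._≟_ (Σ-≡-dec Fin._≟_ Fin._≟_)

  _≟Point_ : DecidableEquality Point
  _≟Point_ = Σ-≡-dec _≟V_ (λ t t′ → yes (T-irrelevant t t′))

  _≟Line_ : DecidableEquality Line
  _≟Line_ = Σ-≡-dec (Σ-≡-dec _≟V_ _≟V_) (λ t t′ → yes (T-irrelevant t t′))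

  _≟Ln_ : DecidableEquality Ln
  L ≟Ln M = map′ toLine-injective (cong toLine) (toLine L ≟Line toLine M)

  infix 4 _I_
  _I_ : Pt → Ln → Set
  pt₁ b c I ln₁₂ c₁ c₂ = c ≡ c₁ +F (b *F c₂)
  pt₁ b _ I ln₁₃ b′ = b ≡ b′
  pt₁ _ _ I ln₂₃ = ⊥
  pt₂ c I ln₁₂ _ c₂ = c ≡ c₂
  pt₂ _ I ln₁₃ _ = ⊥
  pt₂ _ I ln₂₃ = ⊤
  pt₃ I ln₁₂ _ _ = ⊥
  pt₃ I ln₁₃ _ = ⊤
  pt₃ I ln₂₃ = ⊤

  vec : Pt → V
  vec x = proj₁ (toPoint x)

  combination : Ln → F → F → V
  combination (ln₁₂ c₁ c₂) α β = α , β , (α *F c₁) +F (β *F c₂)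
  combination (ln₁₃ b) α β = α , α *F b , β
  combination ln₂₃ α β = 0F , α , β

  V-≡ : ∀ {a b c a′ b′ c′ : F} → a ≡ a′ → b ≡ b′ → c ≡ c′ → _≡_ {A = V} (a , b , c) (a′ , b′ , c′)
  V-≡ refl refl refl = refl

  span-toLine : ∀ L α β → (α · proj₁ (proj₁ (toLine L))) ⊕ (β · proj₂ (proj₁ (toLine L))) ≡ combination L α β
  span-toLine (ln₁₂ c₁ c₂) α β =
    V-≡ (trans (a+b*0≡a _ β) (*F-identityʳ α)) (trans (a*0+b≡b α _) (*F-identityʳ β)) refl
  span-toLine (ln₁₃ b) α β =
    V-≡ (trans (a+b*0≡a _ β) (*F-identityʳ α)) (a+b*0≡a _ β) (trans (a*0+b≡b α _) (*F-identityʳ β))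
  span-toLine ln₂₃ α β =
    V-≡ (trans (a*0+b≡b α _) (*F-zeroʳ β)) (trans (a+b*0≡a _ β) (*F-identityʳ α)) (trans (a*0+b≡b α _) (*F-identityʳ β))

  ·-⊕-scale : ∀ c α β u w → c · ((α · u) ⊕ (β · w)) ≡ ((c *F α) · u) ⊕ ((c *F β) · w)
  ·-⊕-scale c α β (u₁ , u₂ , u₃) (w₁ , w₂ , w₃) = V-≡ (scale u₁ w₁) (scale u₂ w₂) (scale u₃ w₃)
    where
    scale : ∀ x y → c *F ((α *F x) +F (β *F y)) ≡ ((c *F α) *F x) +F ((c *F β) *F y)
    scale x y = trans (*F-distribˡ-+F c (α *F x) (β *F y)) (sym (cong₂ _+F_ (*F-assoc c α x) (*F-assoc c β y)))

  ⊆⇔∈L : ∀ (p : Point) (l : Line) → p ⊆ l ⇔ proj₁ p ∈L l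
  ⊆⇔∈L ((a , b , c) , _) (((u , w) , _)) = mk⇔
    (λ p⊆l → p⊆l (a , b , c) (1F , V-≡ (sym (*F-identityˡ a)) (sym (*F-identityˡ b)) (sym (*F-identityˡ c))))
    (λ { (α , β , e) x (γ , refl) → γ *F α , γ *F β , trans (cong (γ ·_) e) (·-⊕-scale γ α β u w) })

  I⇔span : ∀ x L → x I L ⇔ (∃[ α ] ∃[ β ] vec x ≡ combination L α β)
  I⇔span x L = mk⇔ (I⇒span x L) (span⇒I x L)
    where
    I⇒span : ∀ x L → x I L → ∃[ α ] ∃[ β ] vec x ≡ combination L α β
    I⇒span (pt₁ b c) (ln₁₂ c₁ c₂) e =
      1F , b , cong (λ z → 1F , b , z) (trans e (cong (_+F (b *F c₂)) (sym (*F-identityˡ c₁))))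
    I⇒span (pt₁ b c) (ln₁₃ b′) e = 1F , c , cong (λ z → 1F , z , c) (trans e (sym (*F-identityˡ b′)))
    I⇒span (pt₂ c) (ln₁₂ c₁ c₂) e =
      0F , 1F , cong (λ z → 0F , 1F , z) (trans e (sym (trans (+F-identityˡ _) (*F-identityˡ c₂))))
    I⇒span (pt₂ c) ln₂₃ _ = 1F , c , refl
    I⇒span pt₃ (ln₁₃ b) _ = 0F , 1F , refl
    I⇒span pt₃ ln₂₃ _ = 0F , 1F , refl
    span⇒I : ∀ x L → ∃[ α ] ∃[ β ] vec x ≡ combination L α β → x I L
    span⇒I (pt₁ b c) (ln₁₂ c₁ c₂) (_ , _ , refl) = cong (_+F (b *F c₂)) (*F-identityˡ c₁)
    span⇒I (pt₁ b c) (ln₁₃ b′) (_ , _ , refl) = *F-identityˡ b′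
    span⇒I (pt₂ c) (ln₁₂ c₁ c₂) (_ , _ , refl) = trans (+F-identityˡ _) (*F-identityˡ c₂)
    span⇒I (pt₂ c) ln₂₃ _ = tt
    span⇒I pt₃ (ln₁₃ b) _ = tt
    span⇒I pt₃ ln₂₃ _ = tt
    span⇒I (pt₁ _ _) ln₂₃ (_ , _ , ())
    span⇒I (pt₂ _) (ln₁₃ _) (_ , _ , ())
    span⇒I pt₃ (ln₁₂ _ _) (_ , _ , ())

  ⊆⇔I : ∀ x L → toPoint x ⊆ toLine L ⇔ x I L
  ⊆⇔I x L = ⇔-sym (I⇔span x L) ⇔-∘ (∈L⇔span ⇔-∘ ⊆⇔∈L (toPoint x) (toLine L))
    where
    ∈L⇔span : vec x ∈L toLine L ⇔ (∃[ α ] ∃[ β ] vec x ≡ combination L α β)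
    ∈L⇔span = mk⇔ (λ (α , β , e) → α , β , trans e (span-toLine L α β))
                  (λ (α , β , e) → α , β , trans e (sym (span-toLine L α β)))

  point-determined : ∀ x y → (∀ L → x I L → y I L) → y ≡ x
  point-determined (pt₁ b c) y h = on-both y (h (ln₁₃ b) refl) (h (ln₁₂ c 0F) (sym (a+b*0≡a c b)))
    where
    on-both : ∀ y → y I ln₁₃ b → y I ln₁₂ c 0F → y ≡ pt₁ b c
    on-both (pt₁ b′ c′) refl e = cong (pt₁ b′) (trans e (a+b*0≡a c b′))
    on-both pt₃ _ ()
  point-determined (pt₂ c) y h = on-both y (h (ln₁₂ 0F c) refl) (h ln₂₃ tt)
    where
    on-both : ∀ y → y I ln₁₂ 0F c → y I ln₂₃ → y ≡ pt₂ c
    on-both (pt₂ c′) e _ = cong pt₂ e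
    on-both pt₃ () _
  point-determined pt₃ y h = on-both y (h (ln₁₃ 0F) tt) (h ln₂₃ tt)
    where
    on-both : ∀ y → y I ln₁₃ 0F → y I ln₂₃ → y ≡ pt₃
    on-both pt₃ _ _ = refl

  line-determined : ∀ L M → (∀ x → x I L → x I M) → M ≡ L
  line-determined (ln₁₂ c₁ c₂) M h = through-both M (h (pt₁ 0F c₁) (sym (+F-identityʳ c₁))) (h (pt₂ c₂) refl)
    where
    through-both : ∀ M → pt₁ 0F c₁ I M → pt₂ c₂ I M → M ≡ ln₁₂ c₁ c₂
    through-both (ln₁₂ d₁ d₂) e₁ e₂ = cong₂ ln₁₂ (sym (trans e₁ (+F-identityʳ d₁))) (sym e₂)
  line-determined (ln₁₃ b) M h = through-both M (h (pt₁ b 0F) refl) (h pt₃ tt)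
    where
    through-both : ∀ M → pt₁ b 0F I M → pt₃ I M → M ≡ ln₁₃ b
    through-both (ln₁₃ d) e _ = cong ln₁₃ (sym e)
  line-determined ln₂₃ M h = through-both M (h (pt₂ 0F) tt) (h pt₃ tt)
    where
    through-both : ∀ M → pt₂ 0F I M → pt₃ I M → M ≡ ln₂₃
    through-both ln₂₃ _ _ = refl

  lineThrough : Pt → Ln
  lineThrough (pt₁ b _) = ln₁₃ b
  lineThrough (pt₂ _) = ln₂₃
  lineThrough pt₃ = ln₂₃

  lineThrough-I : ∀ x → x I lineThrough x
  lineThrough-I (pt₁ _ _) = refl
  lineThrough-I (pt₂ _) = tt
  lineThrough-I pt₃ = tt

  -- The elation (x , y , z) ↦ (x , y , z + t x) with axis ln₂₃ and centre pt₃.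
  elation : F → Pt → Pt
  elation t (pt₁ b c) = pt₁ b (c +F t)
  elation t (pt₂ c) = pt₂ c
  elation t pt₃ = pt₃

  elationᴸ : F → Ln → Ln
  elationᴸ t (ln₁₂ c₁ c₂) = ln₁₂ (c₁ +F t) c₂
  elationᴸ t (ln₁₃ b) = ln₁₃ b
  elationᴸ t ln₂₃ = ln₂₃

  elation-inverseˡ : ∀ t x → elation t (elation (-F t) x) ≡ x
  elation-inverseˡ t (pt₁ b c) = cong (pt₁ b) ([a-b]+b≡a c t)
  elation-inverseˡ t (pt₂ c) = refl
  elation-inverseˡ t pt₃ = refl

  elation-inverseʳ : ∀ t x → elation (-F t) (elation t x) ≡ x
  elation-inverseʳ t (pt₁ b c) = cong (pt₁ b) ([a+b]-b≡a c t)
  elation-inverseʳ t (pt₂ c) = refl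
  elation-inverseʳ t pt₃ = refl

  elationᴸ-inverseˡ : ∀ t L → elationᴸ t (elationᴸ (-F t) L) ≡ L
  elationᴸ-inverseˡ t (ln₁₂ c₁ c₂) = cong (λ d → ln₁₂ d c₂) ([a-b]+b≡a c₁ t)
  elationᴸ-inverseˡ t (ln₁₃ b) = refl
  elationᴸ-inverseˡ t ln₂₃ = refl

  elationᴸ-inverseʳ : ∀ t L → elationᴸ (-F t) (elationᴸ t L) ≡ L
  elationᴸ-inverseʳ t (ln₁₂ c₁ c₂) = cong (λ d → ln₁₂ d c₂) ([a+b]-b≡a c₁ t)
  elationᴸ-inverseʳ t (ln₁₃ b) = refl
  elationᴸ-inverseʳ t ln₂₃ = refl

  elation-I : ∀ t x L → x I L ⇔ elation t x I elationᴸ t L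
  elation-I t (pt₁ b c) (ln₁₂ c₁ c₂) = mk⇔
    (λ e → trans (cong (_+F t) e) ([a+b]+c≡[a+c]+b c₁ (b *F c₂) t))
    (λ e → +F-cancelʳ t c (c₁ +F (b *F c₂)) (trans e (sym ([a+b]+c≡[a+c]+b c₁ (b *F c₂) t))))
  elation-I t (pt₁ _ _) (ln₁₃ _) = ⇔-id _
  elation-I t (pt₁ _ _) ln₂₃ = ⇔-id _
  elation-I t (pt₂ _) (ln₁₂ _ _) = ⇔-id _
  elation-I t (pt₂ _) (ln₁₃ _) = ⇔-id _
  elation-I t (pt₂ _) ln₂₃ = ⇔-id _
  elation-I t pt₃ (ln₁₂ _ _) = ⇔-id _
  elation-I t pt₃ (ln₁₃ _) = ⇔-id _
  elation-I t pt₃ ln₂₃ = ⇔-id _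

  elation-I-lineThrough : ∀ t x → elation t x I lineThrough x
  elation-I-lineThrough t (pt₁ _ _) = refl
  elation-I-lineThrough t (pt₂ _) = tt
  elation-I-lineThrough t pt₃ = tt

  axisPoint : Ln → Pt
  axisPoint (ln₁₂ _ c₂) = pt₂ c₂
  axisPoint (ln₁₃ _) = pt₃
  axisPoint ln₂₃ = pt₃

  axisPoint-I : ∀ L → axisPoint L I L
  axisPoint-I (ln₁₂ _ _) = refl
  axisPoint-I (ln₁₃ _) = tt
  axisPoint-I ln₂₃ = tt

  axisPoint-I-elationᴸ : ∀ t L → axisPoint L I elationᴸ t L
  axisPoint-I-elationᴸ t (ln₁₂ _ _) = refl
  axisPoint-I-elationᴸ t (ln₁₃ _) = tt
  axisPoint-I-elationᴸ t ln₂₃ = tt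

  O Y Z : Pt
  O = pt₁ 0F 0F
  Y = pt₂ 0F
  Z = pt₃

  L₁ L₂ : Ln
  L₁ = ln₁₂ -1F 1F
  L₂ = ln₁₂ 1F 1F

  -- The fixed points and lines are propagated by joining and meeting, starting
  -- from Y, W = L₁ ∧ L₂ and the line ln₂₃ = YW, which passes through Z but not O.
  -- The affine points (b , 0) are reached by induction on b, stepping from (k , 0)
  -- to (k + 1 , 0) through the line (k , 0)W and the horizontal line c = 1.
  module Rigidity (τ : Pt → Pt) (ρ : Ln → Ln)
                  (τ-ρ-I : ∀ x L → x I L → τ x I ρ L)
                  (τ-injective : ∀ x y → τ x ≡ τ y → x ≡ y)
                  (τO : τ O ≡ O ⊎ τ O ≡ Z) (τZ : τ Z ≡ O ⊎ τ Z ≡ Z) (τY : τ Y ≡ Y)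
                  (ρL₁ : ρ L₁ ≡ L₁) (ρL₂ : ρ L₂ ≡ L₂) where

    meet-fixed : ∀ L M x → ρ L ≡ L → ρ M ≡ M → x I L → x I M →
                 (∀ y → y I L → y I M → y ≡ x) → τ x ≡ x
    meet-fixed L M x ρL ρM x∈L x∈M unique =
      unique (τ x) (subst (τ x I_) ρL (τ-ρ-I x L x∈L)) (subst (τ x I_) ρM (τ-ρ-I x M x∈M))

    join-fixed : ∀ x y L → τ x ≡ x → τ y ≡ y → x I L → y I L →
                 (∀ M → x I M → y I M → M ≡ L) → ρ L ≡ L
    join-fixed x y L τx τy x∈L y∈L unique =
      unique (ρ L) (subst (_I ρ L) τx (τ-ρ-I x L x∈L)) (subst (_I ρ L) τy (τ-ρ-I y L y∈L))

    W : Pt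
    W = pt₂ 1F

    W-fixed : τ W ≡ W
    W-fixed = meet-fixed L₁ L₂ W ρL₁ ρL₂ refl refl unique
      where
      unique : ∀ y → y I L₁ → y I L₂ → y ≡ W
      unique (pt₁ b c) e₁ e₂ = ⊥-elim (-1F≢1F (+F-cancelʳ (b *F 1F) -1F 1F (trans (sym e₁) e₂)))
      unique (pt₂ c) e₁ _ = cong pt₂ e₁

    ln₂₃-fixed : ρ ln₂₃ ≡ ln₂₃
    ln₂₃-fixed = join-fixed Y W ln₂₃ τY W-fixed tt tt unique
      where
      unique : ∀ M → Y I M → W I M → M ≡ ln₂₃
      unique (ln₁₂ _ _) e₁ e₂ = ⊥-elim (1F≢0F (trans e₂ (sym e₁)))
      unique ln₂₃ _ _ = refl

    Z-fixed : τ Z ≡ Z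
    Z-fixed = [ (λ τZ≡O → ⊥-elim (subst (O I_) ln₂₃-fixed (subst (_I ρ ln₂₃) τZ≡O (τ-ρ-I Z ln₂₃ tt)))) , id ]′ τZ

    O-fixed : τ O ≡ O
    O-fixed = [ id , (λ τO≡Z → ⊥-elim (O≢Z (τ-injective O Z (trans τO≡Z (sym Z-fixed))))) ]′ τO
      where
      O≢Z : O ≢ Z
      O≢Z ()

    H₀ : Ln
    H₀ = ln₁₂ 0F 0F

    H₀-fixed : ρ H₀ ≡ H₀
    H₀-fixed = join-fixed O Y H₀ O-fixed τY refl refl unique
      where
      unique : ∀ M → O I M → Y I M → M ≡ H₀
      unique (ln₁₂ d₁ d₂) e₁ e₂ = cong₂ ln₁₂ (sym (trans e₁ (+F-identityʳ d₁))) (sym e₂)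

    Q : Pt
    Q = pt₁ 1F 0F

    Q-fixed : τ Q ≡ Q
    Q-fixed = meet-fixed L₁ H₀ Q ρL₁ H₀-fixed (sym (trans (a+b*1≡a+b -1F 1F) (+F-inverseˡ 1F))) (sym (a+b*0≡a 0F 1F)) unique
      where
      unique : ∀ y → y I L₁ → y I H₀ → y ≡ Q
      unique (pt₁ b c) e₁ e₂ =
        cong₂ pt₁ (trans (c≡-a+b⇒b≡a+c 1F b 0F (trans (sym c≡0) (trans e₁ (a+b*1≡a+b -1F b)))) (+F-identityʳ 1F)) c≡0
        where
        c≡0 : c ≡ 0F
        c≡0 = trans e₂ (a+b*0≡a 0F b)
      unique (pt₂ c) e₁ e₂ = ⊥-elim (1F≢0F (trans (sym e₁) e₂))

    vertical-fixed : ∀ b c → τ (pt₁ b c) ≡ pt₁ b c → ρ (ln₁₃ b) ≡ ln₁₃ b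
    vertical-fixed b c τx = join-fixed (pt₁ b c) Z (ln₁₃ b) τx Z-fixed refl tt unique
      where
      unique : ∀ M → pt₁ b c I M → Z I M → M ≡ ln₁₃ b
      unique (ln₁₃ d) e _ = cong ln₁₃ (sym e)

    D : Ln
    D = ln₁₂ 0F 1F

    D-fixed : ρ D ≡ D
    D-fixed = join-fixed O W D O-fixed W-fixed refl refl unique
      where
      unique : ∀ M → O I M → W I M → M ≡ D
      unique (ln₁₂ d₁ d₂) e₁ e₂ = cong₂ ln₁₂ (sym (trans e₁ (+F-identityʳ d₁))) (sym e₂)

    diagonal-fixed : ∀ b → τ (pt₁ b 0F) ≡ pt₁ b 0F → τ (pt₁ b b) ≡ pt₁ b b
    diagonal-fixed b τx = meet-fixed (ln₁₃ b) D (pt₁ b b) (vertical-fixed b 0F τx) D-fixed refl (sym (0+b*1≡b b)) unique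
      where
      0+b*1≡b : ∀ b → 0F +F (b *F 1F) ≡ b
      0+b*1≡b b = trans (+F-identityˡ _) (*F-identityʳ b)
      unique : ∀ y → y I ln₁₃ b → y I D → y ≡ pt₁ b b
      unique (pt₁ b′ c′) e₁ e₂ = cong₂ pt₁ e₁ (trans e₂ (trans (0+b*1≡b b′) e₁))

    U : Pt
    U = pt₁ 1F 1F

    H₁ : Ln
    H₁ = ln₁₂ 1F 0F

    H₁-fixed : ρ H₁ ≡ H₁
    H₁-fixed = join-fixed U Y H₁ (diagonal-fixed 1F Q-fixed) τY (sym (a+b*0≡a 1F 1F)) refl unique
      where
      unique : ∀ M → U I M → Y I M → M ≡ H₁
      unique (ln₁₂ d₁ d₂) e₁ refl = cong (λ d → ln₁₂ d 0F) (sym (trans e₁ (a+b*0≡a d₁ 1F)))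

    axis-step : ∀ k → τ (pt₁ k 0F) ≡ pt₁ k 0F → τ (pt₁ (k +F 1F) 0F) ≡ pt₁ (k +F 1F) 0F
    axis-step k τk = meet-fixed (ln₁₃ (k +F 1F)) H₀ (pt₁ (k +F 1F) 0F) (vertical-fixed (k +F 1F) 1F R-fixed) H₀-fixed
                       refl (sym (a+b*0≡a 0F (k +F 1F))) on-axis
      where
      Lₖ : Ln
      Lₖ = ln₁₂ (-F k) 1F
      Lₖ-fixed : ρ Lₖ ≡ Lₖ
      Lₖ-fixed = join-fixed (pt₁ k 0F) W Lₖ τk W-fixed (sym (trans (a+b*1≡a+b (-F k) k) (+F-inverseˡ k))) refl unique
        where
        unique : ∀ M → pt₁ k 0F I M → W I M → M ≡ Lₖ
        unique (ln₁₂ d₁ d₂) e₁ refl = cong (λ d → ln₁₂ d 1F) (+F≡0⇒≡-F d₁ k (sym (trans e₁ (a+b*1≡a+b d₁ k))))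
      R : Pt
      R = pt₁ (k +F 1F) 1F
      R-fixed : τ R ≡ R
      R-fixed = meet-fixed Lₖ H₁ R Lₖ-fixed H₁-fixed (sym (trans (a+b*1≡a+b (-F k) (k +F 1F)) (-a+[a+1]≡1 k)))
                  (sym (a+b*0≡a 1F (k +F 1F))) unique
        where
        unique : ∀ y → y I Lₖ → y I H₁ → y ≡ R
        unique (pt₁ b c) e₁ e₂ =
          cong₂ pt₁ (trans (c≡-a+b⇒b≡a+c k b c (trans e₁ (a+b*1≡a+b (-F k) b))) (cong (k +F_) c≡1)) c≡1
          where
          c≡1 : c ≡ 1F
          c≡1 = trans e₂ (a+b*0≡a 1F b)
        unique (pt₂ c) e₁ e₂ = ⊥-elim (1F≢0F (trans (sym e₁) e₂))
      on-axis : ∀ y → y I ln₁₃ (k +F 1F) → y I H₀ → y ≡ pt₁ (k +F 1F) 0F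
      on-axis (pt₁ b c) e₁ e₂ = cong₂ pt₁ e₁ (trans e₂ (a+b*0≡a 0F b))

    axis-fixed : ∀ b → τ (pt₁ b 0F) ≡ pt₁ b 0F
    axis-fixed b = subst (λ a → τ (pt₁ a 0F) ≡ pt₁ a 0F) (⟦⟧-toℕ b) (reduced-fixed (toℕ b))
      where
      reduced-fixed : ∀ m → τ (pt₁ ⟦ m ⟧ 0F) ≡ pt₁ ⟦ m ⟧ 0F
      reduced-fixed zero = O-fixed
      reduced-fixed (suc m) = subst (λ a → τ (pt₁ a 0F) ≡ pt₁ a 0F) (⟦suc⟧ m) (axis-step ⟦ m ⟧ (reduced-fixed m))

    horizontal-fixed : ∀ c → ρ (ln₁₂ c 0F) ≡ ln₁₂ c 0F
    horizontal-fixed c = join-fixed (pt₁ c c) Y (ln₁₂ c 0F) (diagonal-fixed c (axis-fixed c)) τY (sym (a+b*0≡a c c)) refl unique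
      where
      unique : ∀ M → pt₁ c c I M → Y I M → M ≡ ln₁₂ c 0F
      unique (ln₁₂ d₁ d₂) e₁ refl = cong (λ d → ln₁₂ d 0F) (sym (trans e₁ (a+b*0≡a d₁ c)))

    affine-fixed : ∀ b c → τ (pt₁ b c) ≡ pt₁ b c
    affine-fixed b c = meet-fixed (ln₁₃ b) (ln₁₂ c 0F) (pt₁ b c) (vertical-fixed b 0F (axis-fixed b)) (horizontal-fixed c)
                         refl (sym (a+b*0≡a c b)) unique
      where
      unique : ∀ y → y I ln₁₃ b → y I ln₁₂ c 0F → y ≡ pt₁ b c
      unique (pt₁ b′ c′) e₁ e₂ = cong₂ pt₁ e₁ (trans e₂ (a+b*0≡a c b′))

    infinite-fixed : ∀ c → τ (pt₂ c) ≡ pt₂ c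
    infinite-fixed c = meet-fixed (ln₁₂ 0F c) ln₂₃ (pt₂ c) slope-fixed ln₂₃-fixed refl tt unique
      where
      slope-fixed : ρ (ln₁₂ 0F c) ≡ ln₁₂ 0F c
      slope-fixed = join-fixed O (pt₁ 1F c) (ln₁₂ 0F c) O-fixed (affine-fixed 1F c) refl (sym (0+1*b≡b c)) through-both
        where
        0+1*b≡b : ∀ b → 0F +F (1F *F b) ≡ b
        0+1*b≡b b = trans (+F-identityˡ _) (*F-identityˡ b)
        through-both : ∀ M → O I M → pt₁ 1F c I M → M ≡ ln₁₂ 0F c
        through-both (ln₁₂ d₁ d₂) e₁ e₂ =
          cong₂ ln₁₂ d₁≡0 (sym (trans e₂ (trans (cong (_+F (1F *F d₂)) d₁≡0) (0+1*b≡b d₂))))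
          where
          d₁≡0 : d₁ ≡ 0F
          d₁≡0 = sym (trans e₁ (+F-identityʳ d₁))
        through-both (ln₁₃ d) e₁ e₂ = ⊥-elim (1F≢0F (trans e₂ (sym e₁)))
      unique : ∀ y → y I ln₁₂ 0F c → y I ln₂₃ → y ≡ pt₂ c
      unique (pt₂ c′) e _ = cong pt₂ e

    τ-fixed : ∀ x → τ x ≡ x
    τ-fixed (pt₁ b c) = affine-fixed b c
    τ-fixed (pt₂ c) = infinite-fixed c
    τ-fixed pt₃ = Z-fixed

    ρ-fixed : ∀ L → ρ L ≡ L
    ρ-fixed L = line-determined L (ρ L) (λ x x∈L → subst (_I ρ L) (τ-fixed x) (τ-ρ-I x L x∈L))

  ⊆⇔fromPoint-I-fromLine : ∀ p l → p ⊆ l ⇔ fromPoint p I fromLine l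
  ⊆⇔fromPoint-I-fromLine p l =
    subst₂ (λ p′ l′ → p′ ⊆ l′ ⇔ fromPoint p I fromLine l) (toPoint-fromPoint p) (toLine-fromLine l)
           (⊆⇔I (fromPoint p) (fromLine l))

  ⊆-toLine⇔I : ∀ p L → p ⊆ toLine L ⇔ fromPoint p I L
  ⊆-toLine⇔I p L =
    subst (λ L′ → p ⊆ toLine L ⇔ fromPoint p I L′) (fromLine-toLine L) (⊆⇔fromPoint-I-fromLine p (toLine L))

  toPoint-⊆⇔I : ∀ x l → toPoint x ⊆ l ⇔ x I fromLine l
  toPoint-⊆⇔I x l =
    subst (λ x′ → toPoint x ⊆ l ⇔ x′ I fromLine l) (fromPoint-toPoint x) (⊆⇔fromPoint-I-fromLine (toPoint x) l)

module Copies (n r′ s′ : ℕ) where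
  open Plane n public

  r s : ℕ
  r = 2 + r′
  s = 2 + s′

  G : Graph
  G = LGK r s

  _≟Vertex_ : DecidableEquality (Vertex G)
  _≟Vertex_ = Sum.≡-dec (Σ-≡-dec _≟Point_ Fin._≟_) (Σ-≡-dec _≟Line_ Fin._≟_)

  point-copies-twins : ∀ p i j → Twins G (inj₁ (p , i)) (inj₁ (p , j))
  point-copies-twins p i j (inj₁ _) = ⇔-id _ , ⇔-id _
  point-copies-twins p i j (inj₂ _) = ⇔-id _ , ⇔-id _

  line-copies-twins : ∀ l i j → Twins G (inj₂ (l , i)) (inj₂ (l , j))
  line-copies-twins l i j (inj₁ _) = ⇔-id _ , ⇔-id _
  line-copies-twins l i j (inj₂ _) = ⇔-id _ , ⇔-id _

  twin-points-equal : ∀ {p i p′ j} → Twins G (inj₁ (p , i)) (inj₁ (p′ , j)) → p′ ≡ p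
  twin-points-equal {p} {p′ = p′} t = fromPoint-injective (point-determined (fromPoint p) (fromPoint p′) λ L x∈L →
    Equivalence.to (⊆-toLine⇔I p′ L)
      (Equivalence.to (proj₁ (t (inj₂ (toLine L , Fin.zero)))) (Equivalence.from (⊆-toLine⇔I p L) x∈L)))

  twin-lines-equal : ∀ {l i l′ j} → Twins G (inj₂ (l , i)) (inj₂ (l′ , j)) → l′ ≡ l
  twin-lines-equal {l} {l′ = l′} t = fromLine-injective (line-determined (fromLine l) (fromLine l′) λ x x∈L →
    Equivalence.to (toPoint-⊆⇔I x l′)
      (Equivalence.to (proj₂ (t (inj₁ (toPoint x , Fin.zero)))) (Equivalence.from (toPoint-⊆⇔I x l) x∈L)))

  point-line-not-twins : ∀ {p i l j} → ¬ Twins G (inj₁ (p , i)) (inj₂ (l , j))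
  point-line-not-twins {p} t =
    Equivalence.to (proj₁ (t (inj₂ (toLine L , Fin.zero)))) (Equivalence.from (⊆-toLine⇔I p L) (lineThrough-I (fromPoint p)))
    where L = lineThrough (fromPoint p)

  Point↔Pt : Point ↔ Pt
  Point↔Pt = mk↔ₛ′ fromPoint toPoint fromPoint-toPoint toPoint-fromPoint

  Line↔Ln : Line ↔ Ln
  Line↔Ln = mk↔ₛ′ fromLine toLine fromLine-toLine toLine-fromLine

  Vertex↔coordinates : Vertex G ↔ ((Pt × Fin r) ⊎ (Ln × Fin s))
  Vertex↔coordinates = (Point↔Pt ×-↔ ↔-id _) ⊎-↔ (Line↔Ln ×-↔ ↔-id _)

  collineation-automorphism : (φ : (Pt × Fin r) ↔ (Pt × Fin r)) (ψ : (Ln × Fin s) ↔ (Ln × Fin s)) →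
    (∀ x i L j → x I L ⇔ proj₁ (Inverse.to φ (x , i)) I proj₁ (Inverse.to ψ (L , j))) → Automorphism G
  collineation-automorphism φ ψ I-kept = record
    { perm = ↔-sym Vertex↔coordinates ↔-∘ ((φ ⊎-↔ ψ) ↔-∘ Vertex↔coordinates)
    ; preserve = λ where
        (inj₁ (p , i)) (inj₂ (l , j)) → ⊆-kept p i l j
        (inj₂ (l , j)) (inj₁ (p , i)) → ⊆-kept p i l j
        (inj₁ _) (inj₁ _) → ⇔-id ⊥
        (inj₂ _) (inj₂ _) → ⇔-id ⊥
    }
    where
    ⊆-kept : ∀ p i l j →
             p ⊆ l ⇔ toPoint (proj₁ (Inverse.to φ (fromPoint p , i))) ⊆ toLine (proj₁ (Inverse.to ψ (fromLine l , j)))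
    ⊆-kept p i l j = ⇔-sym (⊆⇔I _ _) ⇔-∘ (I-kept (fromPoint p) i (fromLine l) j ⇔-∘ ⊆⇔fromPoint-I-fromLine p l)

module UpperBound (n r′ s′ : ℕ) where
  open Copies n r′ s′

  K : ℕ
  K = r + s + 1

  hue : (Fin r ⊎ Fin s) ⊎ Fin 1 → Fin K
  hue = Fin.join (r + s) 1 ∘ Sum.map₁ (Fin.join r s)

  hue-injective : ∀ {a b} → hue a ≡ hue b → a ≡ b
  hue-injective e = map₁-join-injective (join-injective (r + s) 1 e)
    where
    map₁-join-injective : ∀ {a b} → Sum.map₁ (Fin.join r s) a ≡ Sum.map₁ (Fin.join r s) b → a ≡ b
    map₁-join-injective {inj₁ _} {inj₁ _} e = cong inj₁ (join-injective r s (Sum.inj₁-injective e))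
    map₁-join-injective {inj₂ _} {inj₂ _} refl = refl

  pointCode : Fin (suc r) → (Fin r ⊎ Fin s) ⊎ Fin 1
  pointCode Fin.zero = inj₂ Fin.zero
  pointCode (Fin.suc i) = inj₁ (inj₁ i)

  lineCode : Fin (suc s) → (Fin r ⊎ Fin s) ⊎ Fin 1
  lineCode Fin.zero = inj₂ Fin.zero
  lineCode (Fin.suc j) = inj₁ (inj₂ j)

  pointCode-injective : ∀ {a b} → pointCode a ≡ pointCode b → a ≡ b
  pointCode-injective {Fin.zero} {Fin.zero} _ = refl
  pointCode-injective {Fin.suc _} {Fin.suc _} refl = refl

  lineCode-injective : ∀ {a b} → lineCode a ≡ lineCode b → a ≡ b
  lineCode-injective {Fin.zero} {Fin.zero} _ = refl
  lineCode-injective {Fin.suc _} {Fin.suc _} refl = refl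

  pointCode≡lineCode : ∀ {a b} → pointCode a ≡ lineCode b → a ≡ Fin.zero × b ≡ Fin.zero
  pointCode≡lineCode {Fin.zero} {Fin.zero} _ = refl , refl
  pointCode≡lineCode {Fin.zero} {Fin.suc _} ()
  pointCode≡lineCode {Fin.suc _} {Fin.zero} ()
  pointCode≡lineCode {Fin.suc _} {Fin.suc _} ()

  lab₀ lab₁ lab₂ : ∀ {k} → Fin (3 + k)
  lab₀ = Fin.zero
  lab₁ = Fin.suc Fin.zero
  lab₂ = Fin.suc (Fin.suc Fin.zero)

  pointLabel : Pt → Fin (suc r)
  pointLabel (pt₁ 0F 0F) = lab₁
  pointLabel pt₃ = lab₁
  pointLabel (pt₂ 0F) = lab₂
  pointLabel _ = lab₀

  pointLabel≡lab₁ : ∀ x → pointLabel x ≡ lab₁ → x ≡ O ⊎ x ≡ Z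
  pointLabel≡lab₁ (pt₁ 0F 0F) _ = inj₁ refl
  pointLabel≡lab₁ pt₃ _ = inj₂ refl
  pointLabel≡lab₁ (pt₁ 0F (Fin.suc _)) ()
  pointLabel≡lab₁ (pt₁ (Fin.suc _) _) ()
  pointLabel≡lab₁ (pt₂ 0F) ()
  pointLabel≡lab₁ (pt₂ (Fin.suc _)) ()

  pointLabel≡lab₂ : ∀ x → pointLabel x ≡ lab₂ → x ≡ Y
  pointLabel≡lab₂ (pt₂ 0F) _ = refl
  pointLabel≡lab₂ (pt₂ (Fin.suc _)) ()
  pointLabel≡lab₂ (pt₁ 0F 0F) ()
  pointLabel≡lab₂ (pt₁ 0F (Fin.suc _)) ()
  pointLabel≡lab₂ (pt₁ (Fin.suc _) _) ()
  pointLabel≡lab₂ pt₃ ()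

  labelled-point : ∀ x → pointLabel x ≢ lab₀ → x ≡ O ⊎ x ≡ Z ⊎ x ≡ Y
  labelled-point (pt₁ 0F 0F) _ = inj₁ refl
  labelled-point pt₃ _ = inj₂ (inj₁ refl)
  labelled-point (pt₂ 0F) _ = inj₂ (inj₂ refl)
  labelled-point (pt₁ 0F (Fin.suc _)) ≢lab₀ = ⊥-elim (≢lab₀ refl)
  labelled-point (pt₁ (Fin.suc _) _) ≢lab₀ = ⊥-elim (≢lab₀ refl)
  labelled-point (pt₂ (Fin.suc _)) ≢lab₀ = ⊥-elim (≢lab₀ refl)

  lineLabel : Ln → Fin (suc s)
  lineLabel L with L ≟Ln L₁ | L ≟Ln L₂
  ... | yes _ | _ = lab₁
  ... | no _ | yes _ = lab₂
  ... | no _ | no _ = lab₀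

  labelled-line : ∀ L → lineLabel L ≢ lab₀ → L ≡ L₁ ⊎ L ≡ L₂
  labelled-line L ≢lab₀ with L ≟Ln L₁ | L ≟Ln L₂
  ... | yes L≡L₁ | _ = inj₁ L≡L₁
  ... | no _ | yes L≡L₂ = inj₂ L≡L₂
  ... | no _ | no _ = ⊥-elim (≢lab₀ refl)

  L₂≢L₁ : L₂ ≢ L₁
  L₂≢L₁ e = -1F≢1F (cong intercept (sym e))
    where
    intercept : Ln → F
    intercept (ln₁₂ c₁ _) = c₁
    intercept _ = 0F

  lineLabel-L₁ : lineLabel L₁ ≡ lab₁
  lineLabel-L₁ with L₁ ≟Ln L₁
  ... | yes _ = refl
  ... | no L₁≢L₁ = ⊥-elim (L₁≢L₁ refl)

  lineLabel-L₂ : lineLabel L₂ ≡ lab₂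
  lineLabel-L₂ with L₂ ≟Ln L₁ | L₂ ≟Ln L₂
  ... | yes L₂≡L₁ | _ = ⊥-elim (L₂≢L₁ L₂≡L₁)
  ... | no _ | yes _ = refl
  ... | no _ | no L₂≢L₂ = ⊥-elim (L₂≢L₂ refl)

  lineLabel≡lab₁ : ∀ L → lineLabel L ≡ lab₁ → L ≡ L₁
  lineLabel≡lab₁ L e with labelled-line L (λ e₀ → case trans (sym e₀) e of λ ())
  ... | inj₁ L≡L₁ = L≡L₁
  ... | inj₂ refl = case trans (sym lineLabel-L₂) e of λ ()

  lineLabel≡lab₂ : ∀ L → lineLabel L ≡ lab₂ → L ≡ L₂
  lineLabel≡lab₂ L e with labelled-line L (λ e₀ → case trans (sym e₀) e of λ ())
  ... | inj₁ refl = case trans (sym lineLabel-L₁) e of λ ()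
  ... | inj₂ L≡L₂ = L≡L₂

  labelled-not-incident : ∀ x L → pointLabel x ≢ lab₀ → lineLabel L ≢ lab₀ → ¬ x I L
  labelled-not-incident x L x≢ L≢ with labelled-point x x≢ | labelled-line L L≢
  ... | inj₁ refl | inj₁ refl = λ i → -1F≢0F (sym (trans i (+F-identityʳ -1F)))
  ... | inj₁ refl | inj₂ refl = λ i → 1F≢0F (sym (trans i (+F-identityʳ 1F)))
  ... | inj₂ (inj₁ refl) | inj₁ refl = λ ()
  ... | inj₂ (inj₁ refl) | inj₂ refl = λ ()
  ... | inj₂ (inj₂ refl) | inj₁ refl = λ i → 1F≢0F (sym i)
  ... | inj₂ (inj₂ refl) | inj₂ refl = λ i → 1F≢0F (sym i)

  -- The copies of a point x receive the colours hue (pointCode a) for all a other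
  -- than pointLabel x: the r point colours if the label is lab₀, and otherwise the
  -- extra colour hue (inj₂ 0) in place of one point colour.
  pointColour : Point → Fin r → Fin K
  pointColour p i = hue (pointCode (punchIn (pointLabel (fromPoint p)) i))

  lineColour : Line → Fin s → Fin K
  lineColour l j = hue (lineCode (punchIn (lineLabel (fromLine l)) j))

  colouring : Vertex G → Fin K
  colouring (inj₁ (p , i)) = pointColour p i
  colouring (inj₂ (l , j)) = lineColour l j

  pointColour-injective : ∀ {p i p′ i′} → pointColour p i ≡ pointColour p′ i′ →
                          punchIn (pointLabel (fromPoint p)) i ≡ punchIn (pointLabel (fromPoint p′)) i′
  pointColour-injective e = pointCode-injective (hue-injective e)

  lineColour-injective : ∀ {l j l′ j′} → lineColour l j ≡ lineColour l′ j′ →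
                         punchIn (lineLabel (fromLine l)) j ≡ punchIn (lineLabel (fromLine l′)) j′
  lineColour-injective e = lineCode-injective (hue-injective e)

  pointColour≡lineColour : ∀ {p i l j} → pointColour p i ≡ lineColour l j →
                           punchIn (pointLabel (fromPoint p)) i ≡ Fin.zero × punchIn (lineLabel (fromLine l)) j ≡ Fin.zero
  pointColour≡lineColour e = pointCode≡lineCode (hue-injective e)

  incident-colours-differ : ∀ {p i l j} → p ⊆ l → pointColour p i ≢ lineColour l j
  incident-colours-differ {p} {i} {l} {j} p⊆l e =
    let (a≡0 , b≡0) = pointColour≡lineColour {p} {i} {l} {j} e in
    labelled-not-incident (fromPoint p) (fromLine l) (punchIn≡zero⇒≢zero (pointLabel (fromPoint p)) i a≡0)
      (punchIn≡zero⇒≢zero (lineLabel (fromLine l)) j b≡0)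
      (Equivalence.to (⊆⇔fromPoint-I-fromLine p l) p⊆l)

  colouring-proper : IsProperColoring G K colouring
  colouring-proper (inj₁ (p , i)) (inj₂ (l , j)) p⊆l e = incident-colours-differ p⊆l e
  colouring-proper (inj₂ (l , j)) (inj₁ (p , i)) p⊆l e = incident-colours-differ p⊆l (sym e)

  module ColourPreserving (σ : Automorphism G) (σ-colour : ∀ v → colouring (apply σ v) ≡ colouring v) where

    second : ∀ {k} → Fin (2 + k)
    second = Fin.suc Fin.zero

    punchIn-second≢zero : ∀ {k} (a : Fin (3 + k)) → punchIn a second ≢ Fin.zero
    punchIn-second≢zero Fin.zero ()
    punchIn-second≢zero (Fin.suc _) ()

    -- The second copy of a vertex never carries the extra colour, so it cannot
    -- be sent to the other side; its twins follow it.
    point-to-point : ∀ p i → Σ (Point × Fin r) λ v → apply σ (inj₁ (p , i)) ≡ inj₁ v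
    point-to-point p i with apply σ (inj₁ (p , i)) in eq
    ... | inj₁ v = v , refl
    ... | inj₂ (l , j) with apply σ (inj₁ (p , second)) in eq₁
    ...   | inj₁ _ = ⊥-elim (point-line-not-twins (subst₂ (Twins G) eq₁ eq (apply-twins σ (point-copies-twins p second i))))
    ...   | inj₂ (l₁ , j₁) = ⊥-elim (punchIn-second≢zero (pointLabel (fromPoint p))
              (proj₁ (pointColour≡lineColour {p} {second} {l₁} {j₁} (trans (sym (σ-colour (inj₁ (p , second)))) (cong colouring eq₁)))))

    line-to-line : ∀ l j → Σ (Line × Fin s) λ v → apply σ (inj₂ (l , j)) ≡ inj₂ v
    line-to-line l j with apply σ (inj₂ (l , j)) in eq
    ... | inj₂ v = v , refl
    ... | inj₁ (p , i) with apply σ (inj₂ (l , second)) in eq₁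
    ...   | inj₂ _ =
      ⊥-elim (point-line-not-twins (twins-sym {G = G} (subst₂ (Twins G) eq₁ eq (apply-twins σ (line-copies-twins l second j)))))
    ...   | inj₁ (p₁ , i₁) = ⊥-elim (punchIn-second≢zero (lineLabel (fromLine l))
              (proj₂ (pointColour≡lineColour {p₁} {i₁} {l} {second} (trans (sym (cong colouring eq₁)) (σ-colour (inj₂ (l , second)))))))

    σᴾ : Point → Point
    σᴾ p = proj₁ (proj₁ (point-to-point p Fin.zero))

    σᴸ : Line → Line
    σᴸ l = proj₁ (proj₁ (line-to-line l Fin.zero))

    pointCopy : Point → Fin r → Fin r
    pointCopy p i = proj₂ (proj₁ (point-to-point p i))

    lineCopy : Line → Fin s → Fin s
    lineCopy l j = proj₂ (proj₁ (line-to-line l j))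

    apply-point : ∀ p i → apply σ (inj₁ (p , i)) ≡ inj₁ (σᴾ p , pointCopy p i)
    apply-point p i = trans (proj₂ (point-to-point p i)) (cong (λ p′ → inj₁ (p′ , pointCopy p i)) same-point)
      where
      same-point : proj₁ (proj₁ (point-to-point p i)) ≡ σᴾ p
      same-point = twin-points-equal (subst₂ (Twins G) (proj₂ (point-to-point p Fin.zero)) (proj₂ (point-to-point p i))
                     (apply-twins σ (point-copies-twins p Fin.zero i)))

    apply-line : ∀ l j → apply σ (inj₂ (l , j)) ≡ inj₂ (σᴸ l , lineCopy l j)
    apply-line l j = trans (proj₂ (line-to-line l j)) (cong (λ l′ → inj₂ (l′ , lineCopy l j)) same-line)
      where
      same-line : proj₁ (proj₁ (line-to-line l j)) ≡ σᴸ l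
      same-line = twin-lines-equal (subst₂ (Twins G) (proj₂ (line-to-line l Fin.zero)) (proj₂ (line-to-line l j))
                    (apply-twins σ (line-copies-twins l Fin.zero j)))

    pointColour-kept : ∀ p i → pointColour (σᴾ p) (pointCopy p i) ≡ pointColour p i
    pointColour-kept p i = trans (cong colouring (sym (apply-point p i))) (σ-colour (inj₁ (p , i)))

    lineColour-kept : ∀ l j → lineColour (σᴸ l) (lineCopy l j) ≡ lineColour l j
    lineColour-kept l j = trans (cong colouring (sym (apply-line l j))) (σ-colour (inj₂ (l , j)))

    pointLabel-kept : ∀ p → pointLabel (fromPoint (σᴾ p)) ≡ pointLabel (fromPoint p)
    pointLabel-kept p = sym (punchIn-image⇒≡ (pointLabel (fromPoint p)) (pointLabel (fromPoint (σᴾ p))) (pointCopy p)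
      λ i → pointColour-injective {σᴾ p} {pointCopy p i} {p} {i} (pointColour-kept p i))

    lineLabel-kept : ∀ l → lineLabel (fromLine (σᴸ l)) ≡ lineLabel (fromLine l)
    lineLabel-kept l = sym (punchIn-image⇒≡ (lineLabel (fromLine l)) (lineLabel (fromLine (σᴸ l))) (lineCopy l)
      λ j → lineColour-injective {σᴸ l} {lineCopy l j} {l} {j} (lineColour-kept l j))

    σᴾ-σᴸ-⊆ : ∀ p l → p ⊆ l → σᴾ p ⊆ σᴸ l
    σᴾ-σᴸ-⊆ p l p⊆l = subst₂ (Adj G) (apply-point p Fin.zero) (apply-line l Fin.zero)
                        (Equivalence.to (preserve σ (inj₁ (p , Fin.zero)) (inj₂ (l , Fin.zero))) p⊆l)

    σᴾ-injective : ∀ {p p′} → σᴾ p ≡ σᴾ p′ → p ≡ p′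
    σᴾ-injective {p} {p′} e = sym (twin-points-equal (unapply-twins σ
      (subst₂ (Twins G) (sym (apply-point p Fin.zero)) (sym (apply-point p′ Fin.zero))
        (subst (λ p″ → Twins G (inj₁ (σᴾ p , pointCopy p Fin.zero)) (inj₁ (p″ , pointCopy p′ Fin.zero))) e
          (point-copies-twins (σᴾ p) _ _)))))

    τ : Pt → Pt
    τ x = fromPoint (σᴾ (toPoint x))

    ρ : Ln → Ln
    ρ L = fromLine (σᴸ (toLine L))

    τ-ρ-I : ∀ x L → x I L → τ x I ρ L
    τ-ρ-I x L x∈L = Equivalence.to (⊆⇔fromPoint-I-fromLine _ _) (σᴾ-σᴸ-⊆ _ _ (Equivalence.from (⊆⇔I x L) x∈L))

    τ-injective : ∀ x y → τ x ≡ τ y → x ≡ y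
    τ-injective x y e = toPoint-injective (σᴾ-injective (fromPoint-injective e))

    ρ-lineLabel : ∀ L → lineLabel (ρ L) ≡ lineLabel L
    ρ-lineLabel L = trans (lineLabel-kept (toLine L)) (cong lineLabel (fromLine-toLine L))

    open Plane.Rigidity n τ ρ τ-ρ-I τ-injective
      (pointLabel≡lab₁ (τ O) (pointLabel-kept (toPoint O))) (pointLabel≡lab₁ (τ Z) (pointLabel-kept (toPoint Z)))
      (pointLabel≡lab₂ (τ Y) (pointLabel-kept (toPoint Y)))
      (lineLabel≡lab₁ (ρ L₁) (trans (ρ-lineLabel L₁) lineLabel-L₁)) (lineLabel≡lab₂ (ρ L₂) (trans (ρ-lineLabel L₂) lineLabel-L₂))

    σᴾ-fixed : ∀ p → σᴾ p ≡ p
    σᴾ-fixed p = fromPoint-injective (subst (λ p′ → fromPoint (σᴾ p′) ≡ fromPoint p) (toPoint-fromPoint p) (τ-fixed (fromPoint p)))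

    σᴸ-fixed : ∀ l → σᴸ l ≡ l
    σᴸ-fixed l = fromLine-injective (subst (λ l′ → fromLine (σᴸ l′) ≡ fromLine l) (toLine-fromLine l) (ρ-fixed (fromLine l)))

    σ-fixes : ∀ v → apply σ v ≡ v
    σ-fixes (inj₁ (p , i)) = trans (apply-point p i) (cong inj₁ (same-copy (σᴾ-fixed p) (pointColour-kept p i)))
      where
      same-copy : ∀ {p′ i′} → p′ ≡ p → pointColour p′ i′ ≡ pointColour p i → (p′ , i′) ≡ (p , i)
      same-copy {i′ = i′} refl e =
        cong (p ,_) (Fin.punchIn-injective (pointLabel (fromPoint p)) _ _ (pointColour-injective {p} {i′} {p} {i} e))
    σ-fixes (inj₂ (l , j)) = trans (apply-line l j) (cong inj₂ (same-copy (σᴸ-fixed l) (lineColour-kept l j)))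
      where
      same-copy : ∀ {l′ j′} → l′ ≡ l → lineColour l′ j′ ≡ lineColour l j → (l′ , j′) ≡ (l , j)
      same-copy {j′ = j′} refl e =
        cong (l ,_) (Fin.punchIn-injective (lineLabel (fromLine l)) _ _ (lineColour-injective {l} {j′} {l} {j} e))

  colouring-distinguishing : IsDistinguishing G K colouring
  colouring-distinguishing σ σ-colour = ColourPreserving.σ-fixes σ σ-colour

  upper-bound : HasDistinguishingColoring G K
  upper-bound = colouring , colouring-proper , colouring-distinguishing

module LowerBound (n r′ s′ : ℕ) where
  open Copies n r′ s′

  module _ {m : ℕ} (c : Vertex G → Fin m) (c-proper : IsProperColoring G m c) (c-distinguishing : IsDistinguishing G m c) where

    cᴾ : Pt → Fin r → Fin m
    cᴾ x i = c (inj₁ (toPoint x , i))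

    cᴸ : Ln → Fin s → Fin m
    cᴸ L j = c (inj₂ (toLine L , j))

    cᴾ-injective : ∀ x {i j} → cᴾ x i ≡ cᴾ x j → i ≡ j
    cᴾ-injective x {i} {j} e = cong proj₂ (Sum.inj₁-injective
      (distinguishing-separates-twins _≟Vertex_ c c-distinguishing (point-copies-twins (toPoint x) i j) e))

    cᴸ-injective : ∀ L {i j} → cᴸ L i ≡ cᴸ L j → i ≡ j
    cᴸ-injective L {i} {j} e = cong proj₂ (Sum.inj₂-injective
      (distinguishing-separates-twins _≟Vertex_ c c-distinguishing (line-copies-twins (toLine L) i j) e))

    incident-colours-differ : ∀ {x L} → x I L → ∀ i j → cᴾ x i ≢ cᴸ L j
    incident-colours-differ {x} {L} x∈L i j =
      c-proper (inj₁ (toPoint x , i)) (inj₂ (toLine L , j)) (Equivalence.from (⊆⇔I x L) x∈L)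

    incident-colours-injective : ∀ {x L} → x I L → ∀ {a b} → [ cᴾ x , cᴸ L ]′ a ≡ [ cᴾ x , cᴸ L ]′ b → a ≡ b
    incident-colours-injective {x} x∈L {inj₁ i} {inj₁ i′} e = cong inj₁ (cᴾ-injective x e)
    incident-colours-injective {L = L} x∈L {inj₂ j} {inj₂ j′} e = cong inj₂ (cᴸ-injective L e)
    incident-colours-injective x∈L {inj₁ i} {inj₂ j} e = ⊥-elim (incident-colours-differ x∈L i j e)
    incident-colours-injective x∈L {inj₂ j} {inj₁ i} e = ⊥-elim (incident-colours-differ x∈L i j (sym e))

    module _ (m≤r+s : m ≤ r + s) where

      incident-cover : ∀ {x L} → x I L → ∀ k → (∃ λ i → cᴾ x i ≡ k) ⊎ (∃ λ j → cᴸ L j ≡ k)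
      incident-cover {x} {L} x∈L k
        with u , e ← injective⇒surjective m≤r+s ([ cᴾ x , cᴸ L ]′ ∘ Fin.splitAt r)
                       (splitAt-injective r s ∘ incident-colours-injective x∈L) k
        with Fin.splitAt r u
      ... | inj₁ i = inj₁ (i , e)
      ... | inj₂ j = inj₂ (j , e)

      collinear-share : ∀ {x y L} → x I L → y I L → ∀ i → ∃ λ i′ → cᴾ y i′ ≡ cᴾ x i
      collinear-share {x} x∈L y∈L i with incident-cover y∈L (cᴾ x i)
      ... | inj₁ found = found
      ... | inj₂ (j , e) = ⊥-elim (incident-colours-differ x∈L i j (sym e))

      concurrent-share : ∀ {x L M} → x I L → x I M → ∀ j → ∃ λ j′ → cᴸ M j′ ≡ cᴸ L j
      concurrent-share {L = L} x∈L x∈M j with incident-cover x∈M (cᴸ L j)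
      ... | inj₂ found = found
      ... | inj₁ (i , e) = ⊥-elim (incident-colours-differ x∈L i j e)

      module MatchPoints = ColourMatching cᴾ cᴾ-injective (elation 1F) (elation -1F) (elation-inverseˡ 1F) (elation-inverseʳ 1F)
        (λ x → collinear-share (lineThrough-I x) (elation-I-lineThrough 1F x))
        (λ x → collinear-share (lineThrough-I x) (elation-I-lineThrough -1F x))

      module MatchLines = ColourMatching cᴸ cᴸ-injective (elationᴸ 1F) (elationᴸ -1F) (elationᴸ-inverseˡ 1F) (elationᴸ-inverseʳ 1F)
        (λ L → concurrent-share (axisPoint-I L) (axisPoint-I-elationᴸ 1F L))
        (λ L → concurrent-share (axisPoint-I L) (axisPoint-I-elationᴸ -1F L))

      elation-automorphism : Automorphism G
      elation-automorphism = collineation-automorphism MatchPoints.matching MatchLines.matching (λ x _ L _ → elation-I 1F x L)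

      elation-colour : ∀ v → c (apply elation-automorphism v) ≡ c v
      elation-colour (inj₁ (p , i)) =
        trans (MatchPoints.lift-colour (fromPoint p) i) (cong (λ p′ → c (inj₁ (p′ , i))) (toPoint-fromPoint p))
      elation-colour (inj₂ (l , j)) =
        trans (MatchLines.lift-colour (fromLine l) j) (cong (λ l′ → c (inj₂ (l′ , j))) (toLine-fromLine l))

      elation-absurd : ⊥
      elation-absurd with () ← toPoint-injective {elation 1F O} {O} (cong proj₁ (Sum.inj₁-injective
                                (c-distinguishing elation-automorphism elation-colour (inj₁ (toPoint O , Fin.zero)))))

  lower-bound : ∀ m → m < r + s + 1 → ¬ HasDistinguishingColoring G m
  lower-bound m m<K (c , c-proper , c-distinguishing) =
    elation-absurd c c-proper c-distinguishing (ℕ.m<1+n⇒m≤n (subst (m <_) (ℕ.+-comm (r + s) 1) m<K))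

LGK-distChromaticNumber : ∀ n r′ s′ → DistChromaticNumber≡ (PG.LGK (3 + n) (2 + r′) (2 + s′)) (2 + r′ + (2 + s′) + 1)
LGK-distChromaticNumber n r′ s′ = UpperBound.upper-bound n r′ s′ , LowerBound.lower-bound n r′ s′

mainTheorem11 : (q : ℕ) {{nz : NonZero q}} → Prime q → 5 ≤ q →
                (r s : ℕ) → 2 ≤ r → 2 ≤ s →
                DistChromaticNumber≡ (PG.LGK q r s) (r + s + 1)
mainTheorem11 _ _ (s≤s (s≤s (s≤s (s≤s (s≤s (z≤n {t})))))) _ _ (s≤s (s≤s (z≤n {r′}))) (s≤s (s≤s (z≤n {s′}))) =
  LGK-distChromaticNumber (2 + t) r′ s′
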